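{- Let $q>0$ be real, $n\geq 1$, and $v,w\in\mathcal{W}_n^q$. Write $w=1^m0^{a_1}1^{b_1}\ldots0^{a_k}1^{b_k}0^\ell$ with $m,\ell\geq 0$, $k\geq 0$ and $q\cdot a_i>b_i\geq 1$ for $1\leq i\leq k$, and write $v=u_1v_1\ldots v_ku_0$ with $|u_1|=m$, $|u_0|=\ell$ and $|v_i|=a_i+b_i$ for $1\leq i\leq k$. Then $w$ covers $v$ (written $v\lessdot w$) if and only if $u_0=0^\ell$ and one of the following holds: (1) $u_1\lessdot 1^m$ and $v_i=0^{a_i}1^{b_i}$ for all $1\leq i\leq k$; (2) $u_1=1^m$ and there is a unique $i$ such that $v_i\lessdot 0^{a_i}1^{b_i}$, while $v_j=0^{a_j}1^{b_j}$ for all $j\neq i$. (Here $u_1\lessdot 1^m$ is a covering in $\mathbb{W}_m^q$ and $v_i\lessdot 0^{a_i}1^{b_i}$ is a covering in $\mathbb{W}_{a_i+b_i}^q$.)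
   Context: A $q$-decreasing word of length $n$ is a binary word of length $n$ in which every maximal factor of the form $0^a1^b$ satisfies either $a=0$ or $q\cdot a>b$; $\mathcal{W}_n^q$ is the set of them, and $\mathbb{W}_n^q$ is this set with the componentwise order ($v\leq w$ iff $v_i\leq w_i$ for all $i$). In a poset, $w$ covers $v$ ($v\lessdot w$) if $v<w$ and there is no $u$ with $v<u<w$. -}

module Defs where

open import Data.Bool using (Bool; true; false)
import Data.Bool as B
open import Data.Nat using (ℕ; zero; suc; _+_; _≤_)
open import Data.Integer using (+_)
open import Data.Rational using (ℚ; 0ℚ; _/_)
import Data.Rational as Q
open import Data.List using (List; []; _∷_; _++_; replicate; length)
open import Data.List.Relation.Binary.Pointwise using (Pointwise)
open import Data.Vec using (Vec; []; _∷_)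
open import Data.Product using (Σ; ∃; _×_; _,_)
open import Data.Empty using (⊥)
open import Data.Sum using (_⊎_)
open import Relation.Binary.PropositionalEquality using (_≡_; _≢_)
open import Relation.Nullary using (¬_)

-- Positive real numbers, as (open, lower) Dedekind cuts of ℚ.
-- `lower p` means  p < q.

record PosReal : Set₁ where
  field
    lower      : ℚ → Set
    positive   : ∃ λ p → (0ℚ Q.< p) × lower p
    bounded    : ∃ λ p → ¬ lower p
    downClosed : ∀ {p r} → p Q.≤ r → lower r → lower p
    rounded    : ∀ {p} → lower p → ∃ λ r → (p Q.< r) × lower r
open PosReal public

-- q · a > b  for natural numbers a, b
QGt : PosReal → ℕ → ℕ → Set
QGt q zero    b = ⊥
QGt q (suc a) b = lower q ((+ b) / suc a)

Word : Set
Word = List Bool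

zeros ones : ℕ → Word
zeros a = replicate a false
ones  b = replicate b true

block : ℕ × ℕ → Word
block (a , b) = zeros a ++ ones b

IsForm : Word → Set
IsForm x = ∃ λ a → ∃ λ b → x ≡ zeros a ++ ones b

MaximalFormFactor : Word → Word → Word → Word → Set
MaximalFormFactor w p x s =
  IsForm x ×
  (∀ p' x' s' → w ≡ p' ++ x' ++ s' → IsForm x' →
     length p' ≤ length p → length s' ≤ length s → length x' ≤ length x)

QDec : PosReal → Word → Set
QDec q w = ∀ p a b s → w ≡ p ++ (zeros a ++ ones b) ++ s →
  MaximalFormFactor w p (zeros a ++ ones b) s → a ≡ 0 ⊎ QGt q a b

_≤w_ : Word → Word → Set
v ≤w w = Pointwise B._≤_ v w

_<w_ : Word → Word → Set
v <w w = v ≤w w × v ≢ w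

-- v ⋖ w in 𝕎_n^q  (n = length w = length v)
Covers : PosReal → Word → Word → Set
Covers q v w = QDec q v × QDec q w × v <w w ×
  (∀ u → QDec q u → v <w u → u <w w → ⊥)

concatBlocks : ∀ {k} → Vec (ℕ × ℕ) k → Word
concatBlocks []         = []
concatBlocks (ab ∷ abs) = block ab ++ concatBlocks abs

concatWords : ∀ {k} → Vec Word k → Word
concatWords []       = []
concatWords (x ∷ xs) = x ++ concatWords xs

-- Being q-decreasing is a local condition: an occurrence of 0^a 1^b with a ≥ 1 is a maximal
-- factor exactly when it is preceded by nothing or a 1, and followed by nothing or, if b ≥ 1, a 0.
-- Hence a q-decreasing word stays q-decreasing when a right part not starting with 1, or a left
-- part not ending in 0, is cut off; and two q-decreasing words glue to one when the right one does
-- not start with 1, since a block straddling the seam extends a block of the right word by more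
-- zeros, and q·a > b is monotone in a.
-- For such a cut w = x y and |v₁| = |x|, a covering v₁ v₂ ⋖ x y therefore takes place in exactly
-- one factor (if v₁ ≠ x and v₂ ≠ y, the word v₁ y lies strictly between), and transfers to a
-- covering of that factor. Cutting w = 1^m · 0^a₁1^b₁ ⋯ 0^aₖ1^bₖ · 0^ℓ at every block boundary,
-- and noting that nothing is covered by 0^ℓ, gives the theorem.

module Submission where

open import Defs
open import Data.Bool using (Bool; true; false; b≤b)
import Data.Bool.Properties as Bool
open import Data.Nat using (ℕ; zero; suc; _+_; _≤_; s≤s)
import Data.Nat.Properties as ℕ
open import Data.Integer using (+_)
import Data.Integer as ℤ
import Data.Integer.Properties as ℤ
open import Data.Rational using (_/_)
import Data.Rational as ℚ
import Data.Rational.Properties as ℚ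
import Data.Rational.Unnormalised as ℚᵘ
import Data.Rational.Unnormalised.Properties as ℚᵘ
open import Data.Fin using (Fin; zero; suc; _≟_)
import Data.Fin.Properties as Fin
open import Data.List using (List; []; _∷_; _++_; _∷ʳ_; [_]; length; replicate; initLast; _∷ʳ′_)
open import Data.List.Properties
  using (++-assoc; ++-conicalʳ; ++-identityʳ; ++-cancelˡ; ++-cancelʳ; ∷-injective; ∷ʳ-injective; ∷ʳ-++;
         length-++; length-++-≤ʳ; length-replicate; ≡-dec)
open import Data.List.Relation.Binary.Pointwise as Pointwise using (Pointwise; []; _∷_; ++⁺; Pointwise-length)
open import Data.Vec using (Vec; []; _∷_; lookup)
open import Data.Product using (∃; ∃₂; _×_; _,_; proj₁; proj₂)
open import Data.Sum using (_⊎_; inj₁; inj₂)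
open import Data.Empty using (⊥; ⊥-elim)
open import Function using (_∘_)
open import Function.Bundles using (_⇔_; mk⇔; Equivalence)
open import Relation.Binary.PropositionalEquality using (_≡_; _≢_; refl; sym; trans; cong; cong₂; subst; subst₂)
open import Relation.Nullary using (¬_; yes; no)

private
  variable
    A : Set
    q : PosReal
    a b k : ℕ
    c : Bool
    p r s t u v w x y : Word

-- (+ b) / suc a is the normal form of the unnormalised fraction b/(1+a), which is compared by
-- cross-multiplication.
/-antitoneʳ : ∀ b {a a'} → a ≤ a' → (+ b) / suc a' ℚ.≤ (+ b) / suc a
/-antitoneʳ b {a} {a'} a≤a' = ℚ.toℚᵘ-cancel-≤
  (ℚᵘ.≤-respˡ-≃ (ℚᵘ.≃-sym (ℚ.toℚᵘ-fromℚᵘ (ℚᵘ.mkℚᵘ (+ b) a')))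
  (ℚᵘ.≤-respʳ-≃ (ℚᵘ.≃-sym (ℚ.toℚᵘ-fromℚᵘ (ℚᵘ.mkℚᵘ (+ b) a)))
  (ℚᵘ.*≤* (subst₂ ℤ._≤_ (ℤ.pos-* b (suc a)) (ℤ.pos-* b (suc a'))
    (ℤ.+≤+ (ℕ.*-monoʳ-≤ b (s≤s a≤a')))))))

qgt-zero : ∀ q a → QGt q (suc a) 0
qgt-zero q a with positive q
... | p , 0<p , p<q = subst (lower q) (sym (ℚ.0/n≡0 (suc a))) (downClosed q (ℚ.<⇒≤ 0<p) p<q)

qgt-mono : ∀ q b {a a'} → a ≤ a' → QGt q (suc a) b → QGt q (suc a') b
qgt-mono q b a≤a' = downClosed q (/-antitoneʳ b a≤a')

++-split : ∀ (x p : List A) {y z} → x ++ y ≡ p ++ z →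
  (∃ λ r → p ≡ x ++ r × y ≡ r ++ z) ⊎ (∃₂ λ c r → x ≡ p ++ c ∷ r × z ≡ c ∷ r ++ y)
++-split []      p       e = inj₁ (p , refl , e)
++-split (c ∷ x) []      e = inj₂ (c , x , refl , sym e)
++-split (c ∷ x) (d ∷ p) e with refl , e' ← ∷-injective e with ++-split x p e'
... | inj₁ (r , p≡xr , y≡rz)        = inj₁ (r , cong (c ∷_) p≡xr , y≡rz)
... | inj₂ (c' , r , x≡pc'r , z≡c'ry) = inj₂ (c' , r , cong (c ∷_) x≡pc'r , z≡c'ry)

++-prefix : ∀ (p' p : List A) {z' z} → p' ++ z' ≡ p ++ z → length p' ≤ length p →
  ∃ λ r → p ≡ p' ++ r × z' ≡ r ++ z
++-prefix []       p       e _       = p , refl , e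
++-prefix (c ∷ p') (d ∷ p) e (s≤s l) with refl , e' ← ∷-injective e with ++-prefix p' p e' l
... | r , p≡p'++r , z'≡r++z = r , cong (c ∷_) p≡p'++r , z'≡r++z

++-suffix : ∀ (x' u : List A) {s' s} → x' ++ s' ≡ u ++ s → length s' ≤ length s →
  ∃ λ t → x' ≡ u ++ t × s ≡ t ++ s'
++-suffix x'       []      e _ = x' , refl , sym e
++-suffix []       (d ∷ u) {s = s} e l =
  ⊥-elim (ℕ.<⇒≱ (s≤s (length-++-≤ʳ s {u})) (subst (_≤ length s) (cong length e) l))
++-suffix (c ∷ x') (d ∷ u) e l with refl , e' ← ∷-injective e with ++-suffix x' u e' l
... | t , x'≡u++t , s≡t++s' = t , cong (c ∷_) x'≡u++t , s≡t++s'

++-injective : ∀ (x y : List A) {xs ys} → x ++ xs ≡ y ++ ys → length x ≡ length y → x ≡ y × xs ≡ ys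
++-injective []      []      e _ = refl , e
++-injective (c ∷ x) (d ∷ y) e l with refl , e' ← ∷-injective e with ++-injective x y e' (ℕ.suc-injective l)
... | refl , xs≡ys = refl , xs≡ys

pointwise-++⁻ : ∀ {R : A → A → Set} (x y : List A) {xs ys} → length x ≡ length y →
  Pointwise R (x ++ xs) (y ++ ys) → Pointwise R x y × Pointwise R xs ys
pointwise-++⁻ []      []      _ rs       = [] , rs
pointwise-++⁻ (c ∷ x) (d ∷ y) l (r ∷ rs) with pointwise-++⁻ x y (ℕ.suc-injective l) rs
... | rx , rxs = r ∷ rx , rxs

pointwise-++-split : ∀ {R : A → A → Set} (x : List A) {xs t} → Pointwise R (x ++ xs) t →
  ∃₂ λ y ys → t ≡ y ++ ys × Pointwise R x y × Pointwise R xs ys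
pointwise-++-split []      rs       = [] , _ , refl , [] , rs
pointwise-++-split (c ∷ x) (r ∷ rs) with pointwise-++-split x rs
... | y , ys , refl , rx , rxs = _ ∷ y , ys , refl , r ∷ rx , rxs

replicate-∷ʳ : ∀ n (c : A) → replicate n c ∷ʳ c ≡ replicate (suc n) c
replicate-∷ʳ zero    c = refl
replicate-∷ʳ (suc n) c = cong (c ∷_) (replicate-∷ʳ n c)

data NoLeading1 : Word → Set where
  []  : NoLeading1 []
  0∷_ : ∀ w → NoLeading1 (false ∷ w)

NoTrailing0 : Word → Set
NoTrailing0 w = w ≡ [] ⊎ ∃ λ r → w ≡ r ∷ʳ true

noLeading1-++ : NoLeading1 x → NoLeading1 y → NoLeading1 (x ++ y)
noLeading1-++ []     ny = ny
noLeading1-++ (0∷ x) _  = 0∷ _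

noLeading1-≤ : v ≤w w → NoLeading1 w → NoLeading1 v
noLeading1-≤ []        []     = []
noLeading1-≤ (b≤b ∷ _) (0∷ w) = 0∷ _

noLeading1-zeros : ∀ n → NoLeading1 (zeros n)
noLeading1-zeros zero    = []
noLeading1-zeros (suc n) = 0∷ _

noTrailing0-from : (∀ r → p ≢ r ∷ʳ false) → NoTrailing0 p
noTrailing0-from {p} no0 with initLast p
... | []          = inj₁ refl
... | r ∷ʳ′ true  = inj₂ (r , refl)
... | r ∷ʳ′ false = ⊥-elim (no0 r refl)

noTrailing0-++ : NoTrailing0 x → NoTrailing0 y → NoTrailing0 (x ++ y)
noTrailing0-++ {x} nx (inj₁ refl)       = subst NoTrailing0 (sym (++-identityʳ x)) nx
noTrailing0-++ {x} _  (inj₂ (r , refl)) = inj₂ (x ++ r , sym (++-assoc x r [ true ]))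

¬noTrailing0-∷ʳ0 : ∀ w → ¬ NoTrailing0 (w ∷ʳ false)
¬noTrailing0-∷ʳ0 w (inj₁ e)       with () ← ++-conicalʳ w [ false ] e
¬noTrailing0-∷ʳ0 w (inj₂ (r , e)) with () ← proj₂ (∷ʳ-injective w r e)

noTrailing0-suffix : ∀ x → NoTrailing0 (x ++ y) → NoTrailing0 y
noTrailing0-suffix x nxy = noTrailing0-from λ r y≡r0 →
  ¬noTrailing0-∷ʳ0 (x ++ r) (subst NoTrailing0 (trans (cong (x ++_) y≡r0) (sym (++-assoc x r [ false ]))) nxy)

noTrailing0-ones : ∀ n → NoTrailing0 (ones n)
noTrailing0-ones zero    = inj₁ refl
noTrailing0-ones (suc n) = inj₂ (ones n , sym (replicate-∷ʳ n true))

length-block : ∀ a b → length (block (a , b)) ≡ a + b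
length-block a b = trans (length-++ (zeros a)) (cong₂ _+_ (length-replicate a) (length-replicate b))

block-∷ʳ1 : ∀ a b → block (a , b) ∷ʳ true ≡ block (a , suc b)
block-∷ʳ1 a b = trans (++-assoc (zeros a) (ones b) [ true ]) (cong (zeros a ++_) (replicate-∷ʳ b true))

block-∷ʳ0 : ∀ a → block (a , 0) ∷ʳ false ≡ block (suc a , 0)
block-∷ʳ0 a = trans (cong (_∷ʳ false) (++-identityʳ (zeros a)))
  (trans (replicate-∷ʳ a false) (sym (++-identityʳ (zeros (suc a)))))

ones-∌0 : ∀ b α β → ones b ≢ α ++ false ∷ β
ones-∌0 zero    []      β ()
ones-∌0 zero    (_ ∷ α) β ()
ones-∌0 (suc b) []      β ()
ones-∌0 (suc b) (_ ∷ α) β e = ones-∌0 b α β (proj₂ (∷-injective e))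

block-suffix : ∀ a b r z → block (suc a , b) ≡ r ++ false ∷ z → ∃ λ a' → a' ≤ a × false ∷ z ≡ block (suc a' , b)
block-suffix a       b []      z e = a , ℕ.≤-refl , sym e
block-suffix zero    b (_ ∷ r) z e = ⊥-elim (ones-∌0 b r z (proj₂ (∷-injective e)))
block-suffix (suc a) b (_ ∷ r) z e with block-suffix a b r z (proj₂ (∷-injective e))
... | a' , a'≤a , e' = a' , ℕ.m≤n⇒m≤1+n a'≤a , e'

Has10 : Word → Set
Has10 x = ∃₂ λ α β → x ≡ α ++ true ∷ false ∷ β

has10-++ : Has10 x → ∀ y → Has10 (x ++ y)
has10-++ (α , β , refl) y = α , β ++ y , ++-assoc α (true ∷ false ∷ β) y

has10-∷ʳ1-++ : ∀ r z → Has10 ((r ∷ʳ true) ++ false ∷ z)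
has10-∷ʳ1-++ r z = r , z , ∷ʳ-++ r true (false ∷ z)

form⇒¬has10 : IsForm x → ¬ Has10 x
form⇒¬has10 (a , b , refl) (α , β , e) = block-∌10 a b α β e
  where
  block-∌10 : ∀ a b α β → block (a , b) ≢ α ++ true ∷ false ∷ β
  block-∌10 zero    b α       β e = ones-∌0 b (α ∷ʳ true) β (trans e (sym (∷ʳ-++ α true (false ∷ β))))
  block-∌10 (suc a) b []      β ()
  block-∌10 (suc a) b (_ ∷ α) β e = block-∌10 a b α β (proj₂ (∷-injective e))

-- A local description of q-decreasing words

-- An occurrence p · 0^(1+a) 1^b · s is a maximal factor of the form 0^c 1^d iff
-- NoTrailing0 p and BlockEnd b s.
data BlockEnd : ℕ → Word → Set where
  []  : ∀ {b} → BlockEnd b []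
  0∷_ : ∀ {b} s → BlockEnd (suc b) (false ∷ s)

LocallyQDec : PosReal → Word → Set
LocallyQDec q w = ∀ p a b s → w ≡ p ++ block (suc a , b) ++ s → NoTrailing0 p → BlockEnd b s → QGt q (suc a) b

blockEnd-prefix : ∀ r → BlockEnd b (r ++ y) → BlockEnd b r
blockEnd-prefix []      _      = []
blockEnd-prefix (_ ∷ r) (0∷ _) = 0∷ r

blockEnd-++ : BlockEnd (suc b) s → NoLeading1 y → BlockEnd (suc b) (s ++ y)
blockEnd-++ []     []     = []
blockEnd-++ []     (0∷ y) = 0∷ y
blockEnd-++ (0∷ s) _      = 0∷ (s ++ _)

maximal-∷ : p ≡ r ∷ʳ c → w ≡ p ++ x ++ s → MaximalFormFactor w p x s → ¬ IsForm (c ∷ x)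
maximal-∷ {p} {r} {c} {w} {x} {s} p≡rc e (_ , maximal) form =
  ℕ.1+n≰n (maximal r (c ∷ x) s (trans e (trans (cong (_++ x ++ s) p≡rc) (∷ʳ-++ r c (x ++ s)))) form r≤p ℕ.≤-refl)
  where
  r≤p : length r ≤ length p
  r≤p = subst (length r ≤_) (sym (trans (cong length p≡rc) (length-++ r))) (ℕ.m≤m+n (length r) 1)

maximal-∷ʳ : w ≡ p ++ x ++ c ∷ s → MaximalFormFactor w p x (c ∷ s) → ¬ IsForm (x ∷ʳ c)
maximal-∷ʳ {w} {p} {x} {c} {s} e (_ , maximal) form =
  ℕ.m+1+n≰m (length x) (subst (_≤ length x) (length-++ x)
    (maximal p (x ∷ʳ c) s (trans e (cong (p ++_) (sym (∷ʳ-++ x c s)))) form ℕ.≤-refl (ℕ.n≤1+n (length s))))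

maximal⇒noTrailing0 : w ≡ p ++ block (a , b) ++ s → MaximalFormFactor w p (block (a , b)) s → NoTrailing0 p
maximal⇒noTrailing0 {a = a} {b} e m = noTrailing0-from λ r p≡r0 → maximal-∷ p≡r0 e m (suc a , b , refl)

maximal⇒blockEnd : w ≡ p ++ block (suc a , b) ++ s → MaximalFormFactor w p (block (suc a , b)) s → BlockEnd b s
maximal⇒blockEnd {s = []}                                 e m = []
maximal⇒blockEnd {b = suc b} {s = false ∷ s}             e m = 0∷ s
maximal⇒blockEnd {a = a} {b = zero} {s = false ∷ s}      e m =
  ⊥-elim (maximal-∷ʳ e m (suc (suc a) , 0 , block-∷ʳ0 (suc a)))
maximal⇒blockEnd {a = a} {b = b}    {s = true ∷ s}       e m =
  ⊥-elim (maximal-∷ʳ e m (suc a , suc b , block-∷ʳ1 (suc a) b))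

block-++-has10 : ∀ a t → BlockEnd b (c ∷ s) → Has10 (block (a , b) ++ c ∷ t)
block-++-has10 {suc b} a t (0∷ _) = subst (λ z → Has10 (z ++ false ∷ t)) (block-∷ʳ1 a b) (has10-∷ʳ1-++ (block (a , b)) t)

boundary⇒maximal : w ≡ p ++ block (suc a , b) ++ s → NoTrailing0 p → BlockEnd b s →
  MaximalFormFactor w p (block (suc a , b)) s
boundary⇒maximal {w} {p} {a} {b} {s} e np be = (suc a , b , refl) , unextendable
  where
  X : Word
  X = block (suc a , b)
  unextendable : ∀ p' x' s' → w ≡ p' ++ x' ++ s' → IsForm x' →
    length p' ≤ length p → length s' ≤ length s → length x' ≤ length X
  unextendable p' x' s' e' form p'≤p s'≤s with ++-prefix p' p (trans (sym e') e) p'≤p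
  ... | [] , _ , x's'≡Xs with ++-suffix x' X x's'≡Xs s'≤s
  ...   | [] , x'≡X , _ = ℕ.≤-reflexive (cong length (trans x'≡X (++-identityʳ X)))
  ...   | c ∷ t , x'≡Xct , s≡ct =
    ⊥-elim (form⇒¬has10 form (subst Has10 (sym x'≡Xct) (block-++-has10 (suc a) t (subst (BlockEnd b) s≡ct be))))
  unextendable p' x' s' e' form p'≤p s'≤s | c ∷ r , p≡p'r , x's'≡rXs with noTrailing0-suffix p' (subst NoTrailing0 p≡p'r np)
  ... | inj₂ (r₀ , cr≡r₀1) with ++-suffix x' ((c ∷ r) ++ X) (trans x's'≡rXs (sym (++-assoc (c ∷ r) X s))) s'≤s
  ... | t , x'≡crXt , _ = ⊥-elim (form⇒¬has10 form (subst Has10 (sym x'≡crXt)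
          (has10-++ (subst (λ z → Has10 (z ++ X)) (sym cr≡r₀1) (has10-∷ʳ1-++ r₀ _)) t)))

qdec⇒local : QDec q w → LocallyQDec q w
qdec⇒local Q p a b s e np be with Q p (suc a) b s e (boundary⇒maximal e np be)
... | inj₂ qa>b = qa>b

local⇒qdec : LocallyQDec q w → QDec q w
local⇒qdec L p zero    b s e _ = inj₁ refl
local⇒qdec L p (suc a) b s e m = inj₂ (L p a b s e (maximal⇒noTrailing0 {a = suc a} {b} e m) (maximal⇒blockEnd e m))

-- Cutting and gluing q-decreasing words

local-++⁻ˡ : LocallyQDec q (x ++ y) → NoLeading1 y → LocallyQDec q x
local-++⁻ˡ {q} L ny p a zero    s e np be = qgt-zero q a
local-++⁻ˡ {q} {x} {y} L ny p a (suc b) s e np be = L p a (suc b) (s ++ y) e' np (blockEnd-++ be ny)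
  where
  e' : x ++ y ≡ p ++ block (suc a , suc b) ++ s ++ y
  e' = trans (cong (_++ y) e) (trans (++-assoc p _ y) (cong (p ++_) (++-assoc (block (suc a , suc b)) s y)))

local-++⁻ʳ : LocallyQDec q (x ++ y) → NoTrailing0 x → LocallyQDec q y
local-++⁻ʳ {x = x} L nx p a b s e np be =
  L (x ++ p) a b s (trans (cong (x ++_) e) (sym (++-assoc x p _))) (noTrailing0-++ nx np) be

local-++ : LocallyQDec q x → LocallyQDec q y → NoLeading1 y → LocallyQDec q (x ++ y)
local-++ {q} Lx Ly ny p a zero s e np be = qgt-zero q a
local-++ {q} {x} {y} Lx Ly ny p a (suc b) s e np be with ++-split x p e
... | inj₁ (r , p≡xr , y≡rXs) = Ly r a (suc b) s y≡rXs (noTrailing0-suffix x (subst NoTrailing0 p≡xr np)) be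
... | inj₂ (c , r , x≡pcr , Xs≡cry) with ++-split (block (suc a , suc b)) (c ∷ r) Xs≡cry
...   | inj₁ (r' , cr≡Xr' , s≡r'y) =
  Lx p a (suc b) r' (trans x≡pcr (cong (p ++_) cr≡Xr')) np (blockEnd-prefix r' (subst (BlockEnd (suc b)) s≡r'y be))
...   | inj₂ (c' , r' , X≡crc'r' , y≡c'r's) with subst NoLeading1 y≡c'r's ny
...     | 0∷ _ with block-suffix a (suc b) (c ∷ r) r' X≡crc'r'
...       | a' , a'≤a , e' = qgt-mono q (suc b) a'≤a (Ly [] a' (suc b) s (trans y≡c'r's (cong (_++ s) e')) (inj₁ refl) be)

qdec-++ : QDec q x → QDec q y → NoLeading1 y → QDec q (x ++ y)
qdec-++ {q} {x} {y} Qx Qy ny = local⇒qdec {q} (local-++ {q} (qdec⇒local {q} {x} Qx) (qdec⇒local {q} {y} Qy) ny)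

qdec-++⁻ˡ : QDec q (x ++ y) → NoLeading1 y → QDec q x
qdec-++⁻ˡ {q} {x} {y} Q ny = local⇒qdec {q} (local-++⁻ˡ {q} {x} (qdec⇒local {q} {x ++ y} Q) ny)

qdec-++⁻ʳ : QDec q (x ++ y) → NoTrailing0 x → QDec q y
qdec-++⁻ʳ {q} {x} {y} Q nx = local⇒qdec {q} (local-++⁻ʳ {q} {x} (qdec⇒local {q} {x ++ y} Q) nx)

≤w-refl : w ≤w w
≤w-refl = Pointwise.refl Bool.≤-refl

≤w-antisym : v ≤w w → w ≤w v → v ≡ w
≤w-antisym v≤w w≤v = Pointwise.Pointwise-≡⇒≡ (Pointwise.antisymmetric Bool.≤-antisym v≤w w≤v)

≤w-zeros : ∀ n → w ≤w zeros n → w ≡ zeros n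
≤w-zeros zero    []          = refl
≤w-zeros (suc n) (b≤b ∷ w≤0) = cong (false ∷_) (≤w-zeros n w≤0)

covers-irrefl : ¬ Covers q w w
covers-irrefl (_ , _ , (_ , w≢w) , _) = w≢w refl

¬covers-zeros : ∀ n → ¬ Covers q w (zeros n)
¬covers-zeros n (_ , _ , (w≤0 , w≢0) , _) = w≢0 (≤w-zeros n w≤0)

module _ (X Y : Word) where

  <w-in-context : v <w w → (X ++ v ++ Y) <w (X ++ w ++ Y)
  <w-in-context {v} {w} (v≤w , v≢w) =
    ++⁺ (≤w-refl {X}) (++⁺ v≤w (≤w-refl {Y})) , v≢w ∘ ++-cancelʳ Y v w ∘ ++-cancelˡ X (v ++ Y) (w ++ Y)

  ≤w-between-in-context : v ≤w w → (X ++ v ++ Y) ≤w t → t ≤w (X ++ w ++ Y) →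
    ∃ λ u → t ≡ X ++ u ++ Y × v ≤w u × u ≤w w
  ≤w-between-in-context {v} {w} v≤w lower upper with pointwise-++-split X lower
  ... | X' , vY' , refl , X≤X' , vY≤vY' with pointwise-++-split v vY≤vY'
  ... | u , Y' , refl , v≤u , Y≤Y' with pointwise-++⁻ X' X (sym (Pointwise-length X≤X')) upper
  ... | X'≤X , uY'≤wY with pointwise-++⁻ u w (trans (sym (Pointwise-length v≤u)) (Pointwise-length v≤w)) uY'≤wY
  ... | u≤w , Y'≤Y with ≤w-antisym X≤X' X'≤X | ≤w-antisym Y≤Y' Y'≤Y
  ... | refl | refl = u , refl , v≤u , u≤w

  covers-in-context : (∀ {t} → t ≤w w → QDec q (X ++ t ++ Y) ⇔ QDec q t) →
    Covers q (X ++ v ++ Y) (X ++ w ++ Y) ⇔ Covers q v w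
  covers-in-context {w} {q} {v} qdec⇔ = mk⇔ to from
    where
    to : Covers q (X ++ v ++ Y) (X ++ w ++ Y) → Covers q v w
    to (Qv' , Qw' , (v'≤w' , v'≢w') , nothing-between) =
      Equivalence.to (qdec⇔ v≤w) Qv' , Equivalence.to (qdec⇔ ≤w-refl) Qw' ,
      (v≤w , v'≢w' ∘ cong (λ z → X ++ z ++ Y)) ,
      λ t Qt v<t t<w → nothing-between (X ++ t ++ Y) (Equivalence.from (qdec⇔ (proj₁ t<w)) Qt)
        (<w-in-context v<t) (<w-in-context t<w)
      where
      v≤w : v ≤w w
      v≤w = Pointwise.++-cancelʳ v w (Pointwise.++-cancelˡ X v'≤w')
    from : Covers q v w → Covers q (X ++ v ++ Y) (X ++ w ++ Y)
    from (Qv , Qw , v<w , nothing-between) =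
      Equivalence.from (qdec⇔ (proj₁ v<w)) Qv , Equivalence.from (qdec⇔ ≤w-refl) Qw ,
      <w-in-context v<w , between
      where
      between : ∀ t → QDec q t → (X ++ v ++ Y) <w t → t <w (X ++ w ++ Y) → ⊥
      between t Qt (v'≤t , v'≢t) (t≤w' , t≢w') with ≤w-between-in-context (proj₁ v<w) v'≤t t≤w'
      ... | u , refl , v≤u , u≤w = nothing-between u (Equivalence.to (qdec⇔ u≤w) Qt)
        (v≤u , v'≢t ∘ cong (λ z → X ++ z ++ Y)) (u≤w , t≢w' ∘ cong (λ z → X ++ z ++ Y))

CoversOneFactor : PosReal → Word → Word → Word → Word → Set
CoversOneFactor q v w x y = Covers q v x × w ≡ y ⊎ v ≡ x × Covers q w y

covers-++ : NoTrailing0 x → NoLeading1 y → QDec q (x ++ y) → length v ≡ length x →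
  Covers q (v ++ w) (x ++ y) ⇔ CoversOneFactor q v w x y
covers-++ {x} {y} {q} {v} {w} nx ny Qxy |v|≡|x| = mk⇔ to from
  where
  Qx : QDec q x
  Qx = qdec-++⁻ˡ {q} Qxy ny
  Qy : QDec q y
  Qy = qdec-++⁻ʳ {q} {x} Qxy nx

  on-prefix : Covers q (v ++ y) (x ++ y) ⇔ Covers q v x
  on-prefix = covers-in-context [] y λ _ → mk⇔ (λ Q → qdec-++⁻ˡ {q} Q ny) (λ Qt → qdec-++ {q} Qt Qy ny)

  on-suffix : Covers q (x ++ w) (x ++ y) ⇔ Covers q w y
  on-suffix = subst₂ (λ w' y' → Covers q (x ++ w') (x ++ y') ⇔ Covers q w y) (++-identityʳ w) (++-identityʳ y)
    (covers-in-context x [] λ {t} t≤y → subst (λ t' → QDec q (x ++ t') ⇔ QDec q t) (sym (++-identityʳ t))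
      (mk⇔ (λ Q → qdec-++⁻ʳ {q} {x} Q nx) (λ Qt → qdec-++ {q} Qx Qt (noLeading1-≤ t≤y ny))))

  to : Covers q (v ++ w) (x ++ y) → CoversOneFactor q v w x y
  to C@(Qvw , _ , (vw≤xy , _) , nothing-between) with pointwise-++⁻ v x |v|≡|x| vw≤xy
  ... | v≤x , w≤y with ≡-dec Bool._≟_ w y | ≡-dec Bool._≟_ v x
  ... | yes w≡y | _       = inj₁ (Equivalence.to on-prefix (subst (λ z → Covers q (v ++ z) (x ++ y)) w≡y C) , w≡y)
  ... | no _    | yes v≡x = inj₂ (v≡x , Equivalence.to on-suffix (subst (λ z → Covers q (z ++ w) (x ++ y)) v≡x C))
  ... | no w≢y  | no v≢x  = ⊥-elim (nothing-between (v ++ y) Qvy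
          (++⁺ (≤w-refl {v}) w≤y , w≢y ∘ ++-cancelˡ v w y) (++⁺ v≤x (≤w-refl {y}) , v≢x ∘ ++-cancelʳ y v x))
    where
    Qvy : QDec q (v ++ y)
    Qvy = qdec-++ {q} (qdec-++⁻ˡ {q} {v} Qvw (noLeading1-≤ w≤y ny)) Qy ny

  from : CoversOneFactor q v w x y → Covers q (v ++ w) (x ++ y)
  from (inj₁ (v⋖x , w≡y)) = subst (λ z → Covers q (v ++ z) (x ++ y)) (sym w≡y) (Equivalence.from on-prefix v⋖x)
  from (inj₂ (v≡x , w⋖y)) = subst (λ z → Covers q (z ++ w) (x ++ y)) (sym v≡x) (Equivalence.from on-suffix w⋖y)

QBlock : PosReal → ℕ × ℕ → Set
QBlock q p = QGt q (proj₁ p) (proj₂ p) × 1 ≤ proj₂ p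

BlockLengths : Vec Word k → Vec (ℕ × ℕ) k → Set
BlockLengths vs ab = ∀ i → length (lookup vs i) ≡ proj₁ (lookup ab i) + proj₂ (lookup ab i)

AreBlocks : Vec Word k → Vec (ℕ × ℕ) k → Set
AreBlocks vs ab = ∀ i → lookup vs i ≡ block (lookup ab i)

CoveredOnlyAt : PosReal → Vec Word k → Vec (ℕ × ℕ) k → Fin k → Set
CoveredOnlyAt q vs ab i =
  Covers q (lookup vs i) (block (lookup ab i)) × (∀ j → j ≢ i → lookup vs j ≡ block (lookup ab j))

qblock-noLeading1 : ∀ p → QBlock q p → NoLeading1 (block p)
qblock-noLeading1 (suc a , b) _ = 0∷ _

qblock-noTrailing0 : ∀ p → QBlock q p → NoTrailing0 (block p)
qblock-noTrailing0 (a , suc b) _ = inj₂ (block (a , b) , sym (block-∷ʳ1 a b))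

noLeading1-concatBlocks : ∀ (ab : Vec (ℕ × ℕ) k) → (∀ i → QBlock q (lookup ab i)) → NoLeading1 (concatBlocks ab)
noLeading1-concatBlocks []       _     = []
noLeading1-concatBlocks (p ∷ ab) valid =
  noLeading1-++ (qblock-noLeading1 p (valid zero)) (noLeading1-concatBlocks ab (valid ∘ suc))

concatWords-blocks : ∀ (vs : Vec Word k) ab → AreBlocks vs ab → concatWords vs ≡ concatBlocks ab
concatWords-blocks []       []       _   = refl
concatWords-blocks (x ∷ vs) (p ∷ ab) v≡b = cong₂ _++_ (v≡b zero) (concatWords-blocks vs ab (v≡b ∘ suc))

concatWords-++-injective : ∀ (vs : Vec Word k) ab → BlockLengths vs ab → concatWords vs ++ u ≡ concatBlocks ab ++ t →
  AreBlocks vs ab × u ≡ t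
concatWords-++-injective []       []            _       e = (λ ()) , e
concatWords-++-injective {u = u} {t} (x ∷ vs) ((a , b) ∷ ab) lengths e
  with ++-injective x (block (a , b)) (trans (sym (++-assoc x _ u)) (trans e (++-assoc (block (a , b)) _ t)))
         (trans (lengths zero) (sym (length-block a b)))
... | x≡block , rest with concatWords-++-injective vs ab (lengths ∘ suc) rest
... | v≡b , u≡t = (λ { zero → x≡block ; (suc i) → v≡b i }) , u≡t

UniquelyCoveredAt : PosReal → Vec Word k → Vec (ℕ × ℕ) k → Fin k → Set
UniquelyCoveredAt q vs ab i = Covers q (lookup vs i) (block (lookup ab i)) ×
  (∀ j → Covers q (lookup vs j) (block (lookup ab j)) → j ≡ i) × (∀ j → j ≢ i → lookup vs j ≡ block (lookup ab j))

coveredOnlyAt⇒uniquelyCoveredAt : ∀ (vs : Vec Word k) ab {i} → CoveredOnlyAt q vs ab i → UniquelyCoveredAt q vs ab i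
coveredOnlyAt⇒uniquelyCoveredAt {q = q} vs ab {i} (vᵢ⋖bᵢ , others) = vᵢ⋖bᵢ , unique , others
  where
  unique : ∀ j → Covers q (lookup vs j) (block (lookup ab j)) → j ≡ i
  unique j vⱼ⋖bⱼ with j ≟ i
  ... | yes j≡i = j≡i
  ... | no  j≢i = ⊥-elim (covers-irrefl (subst (λ z → Covers q z (block (lookup ab j))) (others j j≢i) vⱼ⋖bⱼ))

covers-blocks : ∀ {ℓ u} (vs : Vec Word k) ab → (∀ i → QBlock q (lookup ab i)) → BlockLengths vs ab →
  QDec q (concatBlocks ab ++ zeros ℓ) →
  Covers q (concatWords vs ++ u) (concatBlocks ab ++ zeros ℓ) ⇔ (u ≡ zeros ℓ × ∃ (CoveredOnlyAt q vs ab))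
covers-blocks {ℓ = ℓ} [] [] _ _ _ = mk⇔ (⊥-elim ∘ ¬covers-zeros ℓ) λ ()
covers-blocks {q = q} {ℓ} {u} (x ∷ vs) (p ∷ ab) valid lengths Qw
  rewrite ++-assoc x (concatWords vs) u | ++-assoc (block p) (concatBlocks ab) (zeros ℓ) = mk⇔ (to ∘ Equivalence.to split) (Equivalence.from split ∘ from)
  where
  V W : Word
  V = concatWords vs ++ u
  W = concatBlocks ab ++ zeros ℓ

  rest : Covers q V W ⇔ (u ≡ zeros ℓ × ∃ (CoveredOnlyAt q vs ab))
  rest = covers-blocks vs ab (valid ∘ suc) (lengths ∘ suc) (qdec-++⁻ʳ {q} {block p} Qw (qblock-noTrailing0 p (valid zero)))

  split : Covers q (x ++ V) (block p ++ W) ⇔ CoversOneFactor q x V (block p) W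
  split = covers-++ (qblock-noTrailing0 p (valid zero)) (noLeading1-++ (noLeading1-concatBlocks ab (valid ∘ suc)) (noLeading1-zeros ℓ))
    Qw (trans (lengths zero) (sym (length-block (proj₁ p) (proj₂ p))))

  to : CoversOneFactor q x V (block p) W → u ≡ zeros ℓ × ∃ (CoveredOnlyAt q (x ∷ vs) (p ∷ ab))
  to (inj₁ (x⋖p , e)) with concatWords-++-injective vs ab (lengths ∘ suc) e
  ... | v≡b , u≡0 = u≡0 , zero , x⋖p , λ { zero 0≢0 → ⊥-elim (0≢0 refl) ; (suc j) _ → v≡b j }
  to (inj₂ (x≡p , c)) with Equivalence.to rest c
  ... | u≡0 , i , vᵢ⋖bᵢ , others = u≡0 , suc i , vᵢ⋖bᵢ , λ { zero _ → x≡p ; (suc j) sj≢si → others j (sj≢si ∘ cong suc) }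

  from : u ≡ zeros ℓ × ∃ (CoveredOnlyAt q (x ∷ vs) (p ∷ ab)) → CoversOneFactor q x V (block p) W
  from (u≡0 , zero , x⋖p , others) =
    inj₁ (x⋖p , cong₂ _++_ (concatWords-blocks vs ab λ j → others (suc j) λ ()) u≡0)
  from (u≡0 , suc i , vᵢ⋖bᵢ , others) =
    inj₂ (others zero (λ ()) , Equivalence.from rest (u≡0 , i , vᵢ⋖bᵢ , λ j j≢i → others (suc j) (j≢i ∘ Fin.suc-injective)))

mainTheorem3 : (q : PosReal) (n : ℕ) → 1 ≤ n →
  (v w : Word) → length v ≡ n → length w ≡ n → QDec q v → QDec q w →
  (m ℓ k : ℕ) (ab : Vec (ℕ × ℕ) k) →
  (∀ i → QGt q (proj₁ (lookup ab i)) (proj₂ (lookup ab i)) × 1 ≤ proj₂ (lookup ab i)) →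
  w ≡ ones m ++ concatBlocks ab ++ zeros ℓ →
  (u₁ u₀ : Word) (vs : Vec Word k) →
  length u₁ ≡ m → length u₀ ≡ ℓ →
  (∀ i → length (lookup vs i) ≡ proj₁ (lookup ab i) + proj₂ (lookup ab i)) →
  v ≡ u₁ ++ concatWords vs ++ u₀ →
  Covers q v w ⇔
    (u₀ ≡ zeros ℓ ×
      ((Covers q u₁ (ones m) × (∀ i → lookup vs i ≡ block (lookup ab i)))
      ⊎ (u₁ ≡ ones m ×
          ∃ λ (i : Fin k) →
            Covers q (lookup vs i) (block (lookup ab i)) ×
            (∀ j → Covers q (lookup vs j) (block (lookup ab j)) → j ≡ i) ×
            (∀ j → j ≢ i → lookup vs j ≡ block (lookup ab j)))))
mainTheorem3 q _ _ _ _ _ _ _ Qw m ℓ k ab valid refl u₁ u₀ vs |u₁|≡m _ lengths refl =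
  mk⇔ (to ∘ Equivalence.to split) (Equivalence.from split ∘ from)
  where
  V W : Word
  V = concatWords vs ++ u₀
  W = concatBlocks ab ++ zeros ℓ

  split : Covers q (u₁ ++ V) (ones m ++ W) ⇔ CoversOneFactor q u₁ V (ones m) W
  split = covers-++ (noTrailing0-ones m) (noLeading1-++ (noLeading1-concatBlocks ab valid) (noLeading1-zeros ℓ))
    Qw (trans |u₁|≡m (sym (length-replicate m)))

  blocks : Covers q V W ⇔ (u₀ ≡ zeros ℓ × ∃ (CoveredOnlyAt q vs ab))
  blocks = covers-blocks vs ab valid lengths (qdec-++⁻ʳ {q} {ones m} Qw (noTrailing0-ones m))

  to : CoversOneFactor q u₁ V (ones m) W →
       u₀ ≡ zeros ℓ × (Covers q u₁ (ones m) × AreBlocks vs ab ⊎ u₁ ≡ ones m × ∃ (UniquelyCoveredAt q vs ab))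
  to (inj₁ (u₁⋖1ᵐ , e)) with concatWords-++-injective vs ab lengths e
  ... | v≡b , u₀≡0 = u₀≡0 , inj₁ (u₁⋖1ᵐ , v≡b)
  to (inj₂ (u₁≡1ᵐ , c)) with Equivalence.to blocks c
  ... | u₀≡0 , i , covered = u₀≡0 , inj₂ (u₁≡1ᵐ , i , coveredOnlyAt⇒uniquelyCoveredAt vs ab covered)

  from : u₀ ≡ zeros ℓ × (Covers q u₁ (ones m) × AreBlocks vs ab ⊎ u₁ ≡ ones m × ∃ (UniquelyCoveredAt q vs ab)) →
         CoversOneFactor q u₁ V (ones m) W
  from (u₀≡0 , inj₁ (u₁⋖1ᵐ , v≡b)) = inj₁ (u₁⋖1ᵐ , cong₂ _++_ (concatWords-blocks vs ab v≡b) u₀≡0)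
  from (u₀≡0 , inj₂ (u₁≡1ᵐ , i , vᵢ⋖bᵢ , _ , others)) = inj₂ (u₁≡1ᵐ , Equivalence.from blocks (u₀≡0 , i , vᵢ⋖bᵢ , others))
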